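{- Let $s\ge 1$ and let $G$ be an $n$-vertex orientation with $\alpha(G)\le s$. For a uniformly random permutation $\pi$ of $V(G)$, with probability at least $1-2^{ -\sqrt{n}}$ we have $\alpha(G_\pi)\le 4\sqrt{ns}$.
   Context: An orientation is a digraph with no directed cycle of length $2$. The independence number of a digraph is that of its underlying undirected graph. For a permutation $\pi$ of the vertices of $G$, $G_\pi$ is the spanning subgraph of $G$ consisting of all edges $(u,v)$ with $\pi(u)<\pi(v)$. -}

module Defs where

open import Data.Nat using (ℕ; _≤_; _<_; _*_)
open import Data.Bool using (Bool; true; false)
open import Data.Fin using (Fin)
open import Data.Fin.Subset using (Subset; _∈_; ∣_∣)
open import Data.Fin.Permutation using (Permutation′; _⟨$⟩ʳ_)
open import Data.Product using (_×_; Σ)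
open import Relation.Binary.PropositionalEquality using (_≡_)
open import Relation.Nullary using (¬_)

-- A (loopless) digraph on vertex set Fin n: G u v ≡ true iff (u,v) is an arc.
Digraph : ℕ → Set
Digraph n = Fin n → Fin n → Bool

IsOrientation : ∀ {n} → Digraph n → Set
IsOrientation {n} G =
  ((i : Fin n) → G i i ≡ false) ×
  ((i j : Fin n) → G i j ≡ true → G j i ≡ false)

Arc : ∀ {n} → Digraph n → Fin n → Fin n → Set
Arc G u v = G u v ≡ true

ArcPerm : ∀ {n} → Digraph n → Permutation′ n → Fin n → Fin n → Set
ArcPerm G π u v = (G u v ≡ true) × (Data.Fin._<_ (π ⟨$⟩ʳ u) (π ⟨$⟩ʳ v))

-- Independent set (w.r.t. the underlying undirected graph): no arc in
-- either direction between two members of S.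
Independent : ∀ {n} → (Fin n → Fin n → Set) → Subset n → Set
Independent {n} E S = (u v : Fin n) → u ∈ S → v ∈ S → ¬ E u v

αAtMost : ∀ {n} → (Fin n → Fin n → Set) → ℕ → Set
αAtMost {n} E k = (S : Subset n) → Independent E S → ∣ S ∣ ≤ k

-- "bad" permutation: α(G_π) > 4 √(n s), i.e. some independent set S of G_π
-- with |S|² > 16 n s  (equivalent since |S| is a natural number).
Bad : ∀ {n} → ℕ → Digraph n → Permutation′ n → Set
Bad {n} s G π = Σ (Subset n) λ S →
  Independent (ArcPerm G π) S × (16 * n * s < ∣ S ∣ * ∣ S ∣)

Distinct : ∀ {n} → Permutation′ n → Permutation′ n → Set
Distinct π σ = ¬ ((i : _) → π ⟨$⟩ʳ i ≡ σ ⟨$⟩ʳ i)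

-- Fix the least k with k² > 16ns; every bad permutation π has an independent set S of G_π of size k,
-- so every arc of G inside S points backwards along π. Write π as a word of length n: position i
-- carries the vertex v placed there when v ∉ S, and otherwise the rank of v among the sinks of the
-- subgraph of G induced by the members of S placed at i or later. Such a v is a sink, and the sinks
-- are independent in G, so the rank is below s. Reading the word from the left recovers π, hence
-- there are at most C(n,k) s^k n!/k! bad permutations. With k! ≥ (8k/27)^k and 16ns < k² this gives
-- #bad · 2^(k/3) ≤ n!, and (k/3)² ≥ n lets a ≤ b√n replace k/3 by a/b.

module Submission where

open import Defs
open import Data.Nat using (ℕ; _≤_; _*_; _^_)
open import Data.Nat using (_!)
open import Data.List using (List; length)
open import Data.List.Relation.Unary.All using (All)
open import Data.List.Relation.Unary.AllPairs using (AllPairs)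
open import Data.Fin.Permutation using (Permutation′)

open import Level using (0ℓ)
open import Data.Nat
open import Data.Nat.Properties
open import Data.Nat.DivMod using (m≡m%n+[m/n]*n; m%n<n)
open import Data.Nat.Solver using (module +-*-Solver)
open import Data.Bool using (Bool; true; false; _∧_; _∨_; not; if_then_else_)
open import Data.Bool.Properties using (T-≡; ∧-zeroʳ)
open import Data.Fin as Fin using (Fin; zero; suc; toℕ; fromℕ<)
import Data.Fin.Properties as Finₚ
open import Data.Fin.Induction using (<-wellFounded)
open import Data.Fin.Permutation using (_⟨$⟩ʳ_; _⟨$⟩ˡ_; inverseˡ; inverseʳ)
open import Data.Fin.Subset using (Subset; ⊥; ⁅_⁆; _∪_; ∁; ∣_∣; _∈_; _∉_; _⊆_)
open import Data.Fin.Subset.Properties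
  using (x∈⁅x⁆; p⊆p∪q; q⊆p∪q; p⊂q⇒∣p∣<∣q∣; x∉p⇒x∈∁p; x∈∁p⇒x∉p; ∣∁p∣≡n∸∣p∣; ∉⊥; ∣⊥∣≡0; ∣p∣≤n;
         x∈p∪q⁻; x∈⁅y⁆⇒x≡y)
open import Data.Vec using ([]; _∷_; here; there; lookup; tabulate)
open import Data.Vec.Properties using (lookup∘tabulate; []=⇒lookup; lookup⇒[]=)
import Data.List as List
open import Data.List using ([]; _∷_; [_]; map; _++_; concatMap; allFin)
open import Data.List.Properties using (length-map; length-++; length-tabulate; ∷-injective)
open import Data.List.Membership.Propositional using () renaming (_∈_ to _∈ₗ_)
open import Data.List.Membership.Propositional.Properties
  using (∈-map⁺; ∈-map⁻; ∈-++⁺ˡ; ∈-++⁺ʳ; ∈-allFin; ∈-concatMap⁺; ∈-lookup)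
open import Data.List.Relation.Unary.Any as Any using (here; there)
open import Data.List.Relation.Unary.Any.Properties using (lookup-index)
open import Data.List.Relation.Unary.All as All using ([]; _∷_)
open import Data.List.Relation.Unary.All.Properties using (++⁺; map⁺; concat⁺)
open import Data.List.Relation.Unary.AllPairs using ([]; _∷_)
open import Data.Product using (Σ-syntax; ∃-syntax; _×_; _,_; proj₁; proj₂)
open import Data.Sum using (inj₁; inj₂)
open import Function using (_∘_)
open import Function.Bundles using (Equivalence)
open import Induction.WellFounded as WF using ()
open import Relation.Binary using (Rel; tri<; tri≈; tri>)
open import Relation.Binary.PropositionalEquality
  using (_≡_; refl; sym; trans; cong; cong₂; subst; subst₂; module ≡-Reasoning)
open import Relation.Nullary using (¬_; yes; no; contradiction)
open import Relation.Unary using (Decidable)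
open import Algebra.Properties.CommutativeMonoid.Sum +-0-commutativeMonoid
  using (sum; sum-permute; sum-cong-≗)

open +-*-Solver using (solve; _:+_; _:*_; _:=_; con)

^-distribʳ-* : ∀ m n o → (m * n) ^ o ≡ m ^ o * n ^ o
^-distribʳ-* m n zero = refl
^-distribʳ-* m n (suc o) rewrite ^-distribʳ-* m n o =
  solve 4 (λ m n x y → m :* n :* (x :* y) := m :* x :* (n :* y)) refl m n (m ^ o) (n ^ o)

m*m≤n*n⇒m≤n : ∀ m n → m * m ≤ n * n → m ≤ n
m*m≤n*n⇒m≤n m n mm≤nn with m ≤? n
... | yes m≤n = m≤n
... | no m≰n = contradiction (*-mono-< (≰⇒> m≰n) (≰⇒> m≰n)) (≤⇒≯ mm≤nn)

bernoulli : ∀ a m → a ^ suc m + suc m * a ^ m ≤ suc a ^ suc m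
bernoulli a zero =
  ≤-reflexive (solve 1 (λ a → a :* con 1 :+ con 1 :* con 1 := (con 1 :+ a) :* con 1) refl a)
bernoulli a (suc m) = begin
    a ^ suc (suc m) + suc (suc m) * a ^ suc m
  ≤⟨ m≤m+n _ (suc m * a ^ m) ⟩
    a ^ suc (suc m) + suc (suc m) * a ^ suc m + suc m * a ^ m
  ≡⟨ solve 3 (λ a x m → a :* (a :* x) :+ (con 1 :+ (con 1 :+ m)) :* (a :* x) :+ (con 1 :+ m) :* x
                      := (con 1 :+ a) :* (a :* x :+ (con 1 :+ m) :* x)) refl a (a ^ m) m ⟩
    suc a * (a ^ suc m + suc m * a ^ m)
  ≤⟨ *-monoʳ-≤ (suc a) (bernoulli a m) ⟩
    suc a * suc a ^ suc m
  ∎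
  where open ≤-Reasoning

-- Bernoulli's inequality for a = n (n + 2), where a + 1 = (n + 1)².
[1+1/n]^[n+1]-antitone : ∀ n →
  (2 + n) ^ (2 + n) * n ^ (1 + n) ≤ (1 + n) * ((1 + n) * (1 + n)) ^ (1 + n)
[1+1/n]^[n+1]-antitone n = begin
    (2 + n) ^ (2 + n) * n ^ (1 + n)
  ≡⟨ *-assoc (2 + n) ((2 + n) ^ (1 + n)) (n ^ (1 + n)) ⟩
    (2 + n) * ((2 + n) ^ (1 + n) * n ^ (1 + n))
  ≡⟨ cong ((2 + n) *_) (sym (^-distribʳ-* (2 + n) n (1 + n))) ⟩
    (2 + n) * ((2 + n) * n) ^ (1 + n)
  ≡⟨ cong (λ z → (2 + n) * z ^ (1 + n)) (*-comm (2 + n) n) ⟩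
    (2 + n) * (a * x)
  ≡⟨ solve 3 (λ n a x → (con 2 :+ n) :* (a :* x) := (con 1 :+ n) :* (a :* x) :+ a :* x) refl n a x ⟩
    (1 + n) * (a * x) + a * x
  ≤⟨ +-monoʳ-≤ ((1 + n) * (a * x)) (*-monoˡ-≤ x (≤-trans (n≤1+n a) (≤-reflexive 1+a≡[1+n]²))) ⟩
    (1 + n) * (a * x) + (1 + n) * (1 + n) * x
  ≡⟨ solve 3 (λ n a x → (con 1 :+ n) :* (a :* x) :+ (con 1 :+ n) :* (con 1 :+ n) :* x
                      := (con 1 :+ n) :* (a :* x :+ (con 1 :+ n) :* x)) refl n a x ⟩
    (1 + n) * (a ^ (1 + n) + (1 + n) * a ^ n)
  ≤⟨ *-monoʳ-≤ (1 + n) (bernoulli a n) ⟩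
    (1 + n) * suc a ^ (1 + n)
  ≡⟨ cong (λ z → (1 + n) * z ^ (1 + n)) 1+a≡[1+n]² ⟩
    (1 + n) * ((1 + n) * (1 + n)) ^ (1 + n)
  ∎
  where
  open ≤-Reasoning
  a = n * (2 + n)
  x = a ^ n
  1+a≡[1+n]² : suc a ≡ (1 + n) * (1 + n)
  1+a≡[1+n]² = solve 1 (λ n → con 1 :+ n :* (con 2 :+ n) := (con 1 :+ n) :* (con 1 :+ n)) refl n

[1+1/n]^[n+1]≤27/8 : ∀ m → 8 * (3 + m) ^ (3 + m) ≤ 27 * (2 + m) ^ (3 + m)
[1+1/n]^[n+1]≤27/8 zero = ≤-refl
[1+1/n]^[n+1]≤27/8 (suc m) = *-cancelˡ-≤ (n ^ (1 + n)) {{m^n≢0 n (1 + n)}} (begin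
    n ^ (1 + n) * (8 * (2 + n) ^ (2 + n))
  ≡⟨ solve 2 (λ x y → x :* (con 8 :* y) := con 8 :* (y :* x)) refl (n ^ (1 + n)) ((2 + n) ^ (2 + n)) ⟩
    8 * ((2 + n) ^ (2 + n) * n ^ (1 + n))
  ≤⟨ *-monoʳ-≤ 8 ([1+1/n]^[n+1]-antitone n) ⟩
    8 * ((1 + n) * ((1 + n) * (1 + n)) ^ (1 + n))
  ≡⟨ cong (λ z → 8 * ((1 + n) * z)) (^-distribʳ-* (1 + n) (1 + n) (1 + n)) ⟩
    8 * ((1 + n) * (p * p))
  ≡⟨ solve 2 (λ a p → con 8 :* (a :* (p :* p)) := (a :* p) :* (con 8 :* p)) refl (1 + n) p ⟩
    (1 + n) * p * (8 * p)
  ≤⟨ *-monoʳ-≤ ((1 + n) * p) ([1+1/n]^[n+1]≤27/8 m) ⟩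
    (1 + n) * p * (27 * n ^ (1 + n))
  ≡⟨ solve 2 (λ x y → x :* (con 27 :* y) := y :* (con 27 :* x)) refl ((1 + n) * p) (n ^ (1 + n)) ⟩
    n ^ (1 + n) * (27 * (1 + n) ^ (2 + n))
  ∎)
  where
  open ≤-Reasoning
  n = 2 + m
  p = (1 + n) ^ (1 + n)

[1+1/n]^n≤27/8 : ∀ n → 8 * (1 + n) ^ n ≤ 27 * n ^ n
[1+1/n]^n≤27/8 zero = ≤ᵇ⇒≤ 8 27 _
[1+1/n]^n≤27/8 (suc zero) = ≤ᵇ⇒≤ 16 27 _
[1+1/n]^n≤27/8 (suc (suc m)) = *-cancelˡ-≤ n (begin
    n * (8 * (1 + n) ^ n)
  ≤⟨ *-monoˡ-≤ (8 * (1 + n) ^ n) (n≤1+n n) ⟩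
    (1 + n) * (8 * (1 + n) ^ n)
  ≡⟨ solve 2 (λ a x → a :* (con 8 :* x) := con 8 :* (a :* x)) refl (1 + n) ((1 + n) ^ n) ⟩
    8 * (1 + n) ^ (1 + n)
  ≤⟨ [1+1/n]^[n+1]≤27/8 m ⟩
    27 * n ^ (1 + n)
  ≡⟨ solve 2 (λ a x → con 27 :* (a :* x) := a :* (con 27 :* x)) refl n (n ^ n) ⟩
    n * (27 * n ^ n)
  ∎)
  where
  open ≤-Reasoning
  n = 2 + m

8^n*n^n≤27^n*n! : ∀ n → 8 ^ n * n ^ n ≤ 27 ^ n * n !
8^n*n^n≤27^n*n! zero = ≤-refl
8^n*n^n≤27^n*n! (suc n) = begin
    8 ^ suc n * suc n ^ suc n
  ≡⟨ solve 3 (λ e a x → con 8 :* e :* (a :* x) := a :* (e :* (con 8 :* x)))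
             refl (8 ^ n) (suc n) (suc n ^ n) ⟩
    suc n * (8 ^ n * (8 * suc n ^ n))
  ≤⟨ *-monoʳ-≤ (suc n) (*-monoʳ-≤ (8 ^ n) ([1+1/n]^n≤27/8 n)) ⟩
    suc n * (8 ^ n * (27 * n ^ n))
  ≡⟨ solve 3 (λ a e y → a :* (e :* (con 27 :* y)) := con 27 :* a :* (e :* y))
             refl (suc n) (8 ^ n) (n ^ n) ⟩
    27 * suc n * (8 ^ n * n ^ n)
  ≤⟨ *-monoʳ-≤ (27 * suc n) (8^n*n^n≤27^n*n! n) ⟩
    27 * suc n * (27 ^ n * n !)
  ≡⟨ solve 3 (λ a t f → con 27 :* a :* (t :* f) := con 27 :* t :* (a :* f))
             refl (suc n) (27 ^ n) (n !) ⟩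
    27 ^ suc n * suc n !
  ∎
  where open ≤-Reasoning

[k+j]!≤[k+j]^k*j! : ∀ k j → (k + j) ! ≤ (k + j) ^ k * j !
[k+j]!≤[k+j]^k*j! zero j = ≤-reflexive (sym (+-identityʳ (j !)))
[k+j]!≤[k+j]^k*j! (suc k) j = begin
    suc (k + j) * (k + j) !
  ≤⟨ *-monoʳ-≤ (suc (k + j)) ([k+j]!≤[k+j]^k*j! k j) ⟩
    suc (k + j) * ((k + j) ^ k * j !)
  ≤⟨ *-monoʳ-≤ (suc (k + j)) (*-monoˡ-≤ (j !) (^-monoˡ-≤ k (n≤1+n (k + j)))) ⟩
    suc (k + j) * (suc (k + j) ^ k * j !)
  ≡⟨ *-assoc (suc (k + j)) (suc (k + j) ^ k) (j !) ⟨
    suc (k + j) ^ suc k * j !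
  ∎
  where open ≤-Reasoning

a^[3t+r]*c^t≤b^[3t+r] : ∀ {a b c} → a * (a * (a * c)) ≤ b * (b * b) → a ≤ b →
                        ∀ t r → a ^ (t * 3 + r) * c ^ t ≤ b ^ (t * 3 + r)
a^[3t+r]*c^t≤b^[3t+r] a³c≤b³ a≤b zero r = ≤-trans (≤-reflexive (*-identityʳ _)) (^-monoˡ-≤ r a≤b)
a^[3t+r]*c^t≤b^[3t+r] {a} {b} {c} a³c≤b³ a≤b (suc t) r = begin
    a * (a * (a * x)) * (c * y)
  ≡⟨ solve 4 (λ a c x y → a :* (a :* (a :* x)) :* (c :* y) := a :* (a :* (a :* c)) :* (x :* y))
             refl a c x y ⟩
    a * (a * (a * c)) * (x * y)
  ≤⟨ *-mono-≤ a³c≤b³ (a^[3t+r]*c^t≤b^[3t+r] a³c≤b³ a≤b t r) ⟩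
    b * (b * b) * b ^ (t * 3 + r)
  ≡⟨ solve 2 (λ b z → b :* (b :* b) :* z := b :* (b :* (b :* z))) refl b (b ^ (t * 3 + r)) ⟩
    b * (b * (b * b ^ (t * 3 + r)))
  ∎
  where
  open ≤-Reasoning
  x = a ^ (t * 3 + r)
  y = c ^ t

729^n*2^[n/3]≤1024^n : ∀ n → 729 ^ n * 2 ^ (n / 3) ≤ 1024 ^ n
729^n*2^[n/3]≤1024^n n = subst (λ m → 729 ^ m * 2 ^ (n / 3) ≤ 1024 ^ m) [n/3]*3+n%3≡n
  (a^[3t+r]*c^t≤b^[3t+r] (≤ᵇ⇒≤ (729 * (729 * (729 * 2))) (1024 * (1024 * 1024)) _) (≤ᵇ⇒≤ 729 1024 _)
                         (n / 3) (n % 3))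
  where
  [n/3]*3+n%3≡n : n / 3 * 3 + n % 3 ≡ n
  [n/3]*3+n%3≡n = trans (+-comm (n / 3 * 3) (n % 3)) (sym (m≡m%n+[m/n]*n n 3))

-- (k!)² ≥ (8k/27)^(2k) and (ns)^k < (k²/16)^k leave a factor (1024/729)^k, which exceeds 2^(k/3).
[k+j]!*s^k*2^[k/3]≤k!*j!*k! : ∀ k j s → 16 * (k + j) * s < k * k →
                              (k + j) ! * s ^ k * 2 ^ (k / 3) ≤ k ! * j ! * k !
[k+j]!*s^k*2^[k/3]≤k!*j!*k! k j s 16ns<k² = *-cancelˡ-≤ (729 ^ k) {{m^n≢0 729 k}} (begin
    729 ^ k * ((k + j) ! * s ^ k * t)
  ≤⟨ *-monoʳ-≤ (729 ^ k) (*-monoˡ-≤ t (*-monoˡ-≤ (s ^ k) ([k+j]!≤[k+j]^k*j! k j))) ⟩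
    729 ^ k * (n ^ k * j ! * s ^ k * t)
  ≡⟨ solve 5 (λ a x f y z → a :* (x :* f :* y :* z) := (a :* z) :* (x :* y) :* f)
             refl (729 ^ k) (n ^ k) (j !) (s ^ k) t ⟩
    729 ^ k * t * (n ^ k * s ^ k) * j !
  ≤⟨ *-monoˡ-≤ (j !) (*-monoˡ-≤ (n ^ k * s ^ k) (729^n*2^[n/3]≤1024^n k)) ⟩
    1024 ^ k * (n ^ k * s ^ k) * j !
  ≡⟨ cong (λ z → 1024 ^ k * z * j !) (^-distribʳ-* n s k) ⟨
    1024 ^ k * (n * s) ^ k * j !
  ≡⟨ cong (_* j !) (^-distribʳ-* 1024 (n * s) k) ⟨
    (1024 * (n * s)) ^ k * j !
  ≡⟨ cong (λ z → z ^ k * j !) (solve 2 (λ n s → con 1024 :* (n :* s) := con 64 :* (con 16 :* n :* s)) refl n s) ⟩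
    (64 * (16 * n * s)) ^ k * j !
  ≤⟨ *-monoˡ-≤ (j !) (^-monoˡ-≤ k (*-monoʳ-≤ 64 (<⇒≤ 16ns<k²))) ⟩
    (64 * (k * k)) ^ k * j !
  ≡⟨ cong (_* j !) (trans (^-distribʳ-* 64 (k * k) k)
                           (cong₂ _*_ (^-distribʳ-* 8 8 k) (^-distribʳ-* k k k))) ⟩
    8 ^ k * 8 ^ k * (k ^ k * k ^ k) * j !
  ≡⟨ solve 3 (λ e x f → e :* e :* (x :* x) :* f := (e :* x) :* (e :* x) :* f)
             refl (8 ^ k) (k ^ k) (j !) ⟩
    (8 ^ k * k ^ k) * (8 ^ k * k ^ k) * j !
  ≤⟨ *-monoˡ-≤ (j !) (*-mono-≤ (8^n*n^n≤27^n*n! k) (8^n*n^n≤27^n*n! k)) ⟩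
    (27 ^ k * k !) * (27 ^ k * k !) * j !
  ≡⟨ solve 3 (λ e x f → (e :* x) :* (e :* x) :* f := e :* e :* (x :* f :* x))
             refl (27 ^ k) (k !) (j !) ⟩
    27 ^ k * 27 ^ k * (k ! * j ! * k !)
  ≡⟨ cong (_* (k ! * j ! * k !)) (^-distribʳ-* 27 27 k) ⟨
    729 ^ k * (k ! * j ! * k !)
  ∎)
  where
  open ≤-Reasoning
  n = k + j
  t = 2 ^ (k / 3)

n≤[k/3]² : ∀ n k → 16 * n < k * k → n ≤ k / 3 * (k / 3)
n≤[k/3]² n k 16n<k² with n ≤? k / 3 * (k / 3)
... | yes n≤t² = n≤t²
... | no n≰t² = contradiction 16n<k² (≤⇒≯ (begin
    k * k
  ≡⟨ cong₂ _*_ k≡r+t*3 k≡r+t*3 ⟩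
    (r + t * 3) * (r + t * 3)
  ≤⟨ *-mono-≤ r+t*3≤2+t*3 r+t*3≤2+t*3 ⟩
    (2 + t * 3) * (2 + t * 3)
  ≤⟨ [2+3t]²≤16[1+t²] t ⟩
    16 * suc (t * t)
  ≤⟨ *-monoʳ-≤ 16 (≰⇒> n≰t²) ⟩
    16 * n
  ∎))
  where
  open ≤-Reasoning
  t = k / 3
  r = k % 3
  k≡r+t*3 : k ≡ r + t * 3
  k≡r+t*3 = m≡m%n+[m/n]*n k 3
  r+t*3≤2+t*3 : r + t * 3 ≤ 2 + t * 3
  r+t*3≤2+t*3 = +-monoˡ-≤ (t * 3) (≤-pred (m%n<n k 3))
  [2+3t]²≤16[1+t²] : ∀ t → (2 + t * 3) * (2 + t * 3) ≤ 16 * suc (t * t)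
  [2+3t]²≤16[1+t²] zero = ≤ᵇ⇒≤ 4 16 _
  [2+3t]²≤16[1+t²] (suc zero) = ≤ᵇ⇒≤ 25 32 _
  [2+3t]²≤16[1+t²] (suc (suc u)) = ≤-trans (m≤m+n _ (7 * (u * u) + 16 * u + 16))
    (≤-reflexive (solve 1 (λ u → (con 2 :+ (con 2 :+ u) :* con 3) :* (con 2 :+ (con 2 :+ u) :* con 3)
                                  :+ (con 7 :* (u :* u) :+ con 16 :* u :+ con 16)
                              := con 16 :* (con 1 :+ (con 2 :+ u) :* (con 2 :+ u))) refl u))

a≤[k/3]*b : ∀ n k a b → 16 * n < k * k → a * a ≤ n * (b * b) → a ≤ k / 3 * b
a≤[k/3]*b n k a b 16n<k² a²≤nb² = m*m≤n*n⇒m≤n a (k / 3 * b) (begin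
    a * a
  ≤⟨ a²≤nb² ⟩
    n * (b * b)
  ≤⟨ *-monoˡ-≤ (b * b) (n≤[k/3]² n k 16n<k²) ⟩
    k / 3 * (k / 3) * (b * b)
  ≡⟨ solve 2 (λ t b → t :* t :* (b :* b) := t :* b :* (t :* b)) refl (k / 3) b ⟩
    k / 3 * b * (k / 3 * b)
  ∎)
  where open ≤-Reasoning

length-concatMap-≤ : ∀ {a b} {A : Set a} {B : Set b} {c} (f : A → List B) {xs} →
                     All (λ x → length (f x) ≤ c) xs → length (concatMap f xs) ≤ c * length xs
length-concatMap-≤ {c = c} f [] = ≤-reflexive (sym (*-zeroʳ c))
length-concatMap-≤ {c = c} f {x ∷ xs} (fx≤c ∷ fxs≤c) = begin
    length (f x ++ concatMap f xs)
  ≡⟨ length-++ (f x) ⟩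
    length (f x) + length (concatMap f xs)
  ≤⟨ +-mono-≤ fx≤c (length-concatMap-≤ f fxs≤c) ⟩
    c + c * length xs
  ≡⟨ *-suc c (length xs) ⟨
    c * suc (length xs)
  ∎
  where open ≤-Reasoning

∣p∣<∣⁅x⁆∪p∣ : ∀ {n x} (p : Subset n) → x ∉ p → ∣ p ∣ < ∣ ⁅ x ⁆ ∪ p ∣
∣p∣<∣⁅x⁆∪p∣ {x = x} p x∉p = p⊂q⇒∣p∣<∣q∣ (q⊆p∪q ⁅ x ⁆ p , x , p⊆p∪q p (x∈⁅x⁆ x) , x∉p)

members : ∀ {n} → Subset n → List (Fin n)
members [] = []
members (true ∷ p) = zero ∷ map suc (members p)
members (false ∷ p) = map suc (members p)

length-members : ∀ {n} (p : Subset n) → length (members p) ≡ ∣ p ∣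
length-members [] = refl
length-members (true ∷ p) = cong suc (trans (length-map suc (members p)) (length-members p))
length-members (false ∷ p) = trans (length-map suc (members p)) (length-members p)

∈⇒∈members : ∀ {n} {x : Fin n} {p : Subset n} → x ∈ p → x ∈ₗ members p
∈⇒∈members {p = true ∷ p} here = here refl
∈⇒∈members {p = true ∷ p} (there x∈p) = there (∈-map⁺ suc (∈⇒∈members x∈p))
∈⇒∈members {p = false ∷ p} (there x∈p) = ∈-map⁺ suc (∈⇒∈members x∈p)

∈members⇒∈ : ∀ {n} {x : Fin n} (p : Subset n) → x ∈ₗ members p → x ∈ p
∈members⇒∈ (true ∷ p) (here refl) = here
∈members⇒∈ (true ∷ p) (there x∈) with ∈-map⁻ suc x∈
... | y , y∈ , refl = there (∈members⇒∈ p y∈)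
∈members⇒∈ (false ∷ p) x∈ with ∈-map⁻ suc x∈
... | y , y∈ , refl = there (∈members⇒∈ p y∈)

tabulate-injective : ∀ {a} {A : Set a} {m} (f g : Fin m → A) →
                     List.tabulate f ≡ List.tabulate g → ∀ i → f i ≡ g i
tabulate-injective {m = suc m} f g eq zero = proj₁ (∷-injective eq)
tabulate-injective {m = suc m} f g eq (suc i) =
  tabulate-injective (f ∘ suc) (g ∘ suc) (proj₂ (∷-injective eq)) i

least-witness : ∀ {p} {P : ℕ → Set p} → Decidable P → ∀ m → P m →
                Σ[ k ∈ ℕ ] P k × (∀ {x} → P x → k ≤ x)
least-witness P? m pm with P? 0
... | yes p0 = 0 , p0 , λ _ → z≤n
least-witness P? zero pm | no ¬p0 = contradiction pm ¬p0
least-witness {P = P} P? (suc m) pm | no ¬p0 with least-witness {P = P ∘ suc} (P? ∘ suc) m pm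
... | k , pk , k-least =
  suc k , pk , λ { {zero} p0 → contradiction p0 ¬p0 ; {suc x} px → s≤s (k-least px) }

subset-of-size : ∀ {m} (S : Subset m) {k} → k ≤ ∣ S ∣ → Σ[ S′ ∈ Subset m ] S′ ⊆ S × ∣ S′ ∣ ≡ k
subset-of-size {m} S {zero} _ = ⊥ , (λ x∈⊥ → contradiction x∈⊥ ∉⊥) , ∣⊥∣≡0 m
subset-of-size (true ∷ S) {suc k} (s≤s k≤∣S∣) with subset-of-size S k≤∣S∣
... | S′ , S′⊆S , ∣S′∣≡k =
  true ∷ S′ , (λ { here → here ; (there x∈) → there (S′⊆S x∈) }) , cong suc ∣S′∣≡k
subset-of-size (false ∷ S) {suc k} k<∣S∣ with subset-of-size S k<∣S∣
... | S′ , S′⊆S , ∣S′∣≡k = false ∷ S′ , (λ { (there x∈) → there (S′⊆S x∈) }) , ∣S′∣≡k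

Independent-⊆ : ∀ {n} {E : Fin n → Fin n → Set} {S S′ : Subset n} →
                S′ ⊆ S → Independent E S → Independent E S′
Independent-⊆ S′⊆S indep u v u∈ v∈ = indep u v (S′⊆S u∈) (S′⊆S v∈)

AllPairs-lookup : ∀ {a r} {A : Set a} {R : Rel A r} {xs : List A} → AllPairs R xs →
                  ∀ {i j} → i Fin.< j → R (List.lookup xs i) (List.lookup xs j)
AllPairs-lookup (Rx ∷ _) {zero} {suc j} _ = All.lookup Rx (∈-lookup j)
AllPairs-lookup (_ ∷ Rxs) {suc i} {suc j} (s≤s i<j) = AllPairs-lookup Rxs i<j

length≤-by-separating-code : ∀ {a r} {A : Set a} {R : Rel A r} {xs : List A} {m} → AllPairs R xs →
                             (c : Fin (length xs) → Fin m) →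
                             (∀ i j → c i ≡ c j → ¬ R (List.lookup xs i) (List.lookup xs j)) →
                             length xs ≤ m
length≤-by-separating-code {xs = xs} R-pairs c separates = Finₚ.injective⇒≤ c-injective
  where
  c-injective : ∀ {i j} → c i ≡ c j → i ≡ j
  c-injective {i} {j} ci≡cj with Finₚ.<-cmp i j
  ... | tri< i<j _ _ = contradiction (AllPairs-lookup R-pairs i<j) (separates i j ci≡cj)
  ... | tri≈ _ i≡j _ = i≡j
  ... | tri> _ _ j<i = contradiction (AllPairs-lookup R-pairs j<i) (separates j i (sym ci≡cj))

sum-mono-≤ : ∀ {m} {f g : Fin m → ℕ} → (∀ i → f i ≤ g i) → sum f ≤ sum g
sum-mono-≤ {zero} f≤g = z≤n
sum-mono-≤ {suc m} f≤g = +-mono-≤ (f≤g zero) (sum-mono-≤ (f≤g ∘ suc))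

sum-mono-< : ∀ {m} {f g : Fin m → ℕ} → (∀ i → f i ≤ g i) → ∀ x → f x < g x → sum f < sum g
sum-mono-< f≤g zero fx<gx = +-mono-<-≤ fx<gx (sum-mono-≤ (f≤g ∘ suc))
sum-mono-< f≤g (suc x) fx<gx = +-mono-≤-< (f≤g zero) (sum-mono-< (f≤g ∘ suc) x fx<gx)

bit : Bool → ℕ
bit b = if b then 1 else 0

count : ∀ {m} → (Fin m → Bool) → ℕ
count p = sum (bit ∘ p)

bit-mono : ∀ {b c} → (b ≡ true → c ≡ true) → bit b ≤ bit c
bit-mono {false} _ = z≤n
bit-mono {true} b⇒c rewrite b⇒c refl = ≤-refl

count-cong : ∀ {m} {p q : Fin m → Bool} → (∀ i → p i ≡ q i) → count p ≡ count q
count-cong p≗q = sum-cong-≗ (cong bit ∘ p≗q)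

count-mono-< : ∀ {m} {p q : Fin m → Bool} → (∀ i → p i ≡ true → q i ≡ true) →
               ∀ x → p x ≡ false → q x ≡ true → count p < count q
count-mono-< p⇒q x px qx =
  sum-mono-< (bit-mono ∘ p⇒q) x (subst₂ (λ b c → bit b < bit c) (sym px) (sym qx) ≤-refl)

count-lookup : ∀ {m} (S : Subset m) → count (lookup S) ≡ ∣ S ∣
count-lookup [] = refl
count-lookup (true ∷ S) = cong suc (count-lookup S)
count-lookup (false ∷ S) = count-lookup S

count+count-not : ∀ {m} (p : Fin m → Bool) → count p + count (not ∘ p) ≡ m
count+count-not {zero} p = refl
count+count-not {suc m} p with p zero
... | true = cong suc (count+count-not (p ∘ suc))
... | false = trans (+-suc (count (p ∘ suc)) _) (cong suc (count+count-not (p ∘ suc)))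

count-permute : ∀ {m} (p : Fin m → Bool) (π : Permutation′ m) → count (p ∘ (π ⟨$⟩ˡ_)) ≡ count p
count-permute {m} p π =
  trans (sum-permute (bit ∘ p ∘ (π ⟨$⟩ˡ_)) π) (sum-cong-≗ {m} (λ u → cong (bit ∘ p) (inverseˡ π {u})))

anyFin : ∀ {m} → (Fin m → Bool) → Bool
anyFin {zero} p = false
anyFin {suc m} p = p zero ∨ anyFin (p ∘ suc)

anyFin-false⁺ : ∀ {m} (p : Fin m → Bool) → (∀ i → ¬ p i ≡ true) → anyFin p ≡ false
anyFin-false⁺ {zero} p _ = refl
anyFin-false⁺ {suc m} p ¬p with p zero in p0
... | true = contradiction p0 (¬p zero)
... | false = anyFin-false⁺ (p ∘ suc) (¬p ∘ suc)

anyFin-false⁻ : ∀ {m} (p : Fin m → Bool) → anyFin p ≡ false → ∀ i → p i ≡ false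
anyFin-false⁻ {suc m} p any≡false i with p zero in p0
anyFin-false⁻ {suc m} p any≡false zero | false = p0
anyFin-false⁻ {suc m} p any≡false (suc i) | false = anyFin-false⁻ (p ∘ suc) any≡false i

anyFin-cong : ∀ {m} {p q : Fin m → Bool} → (∀ i → p i ≡ q i) → anyFin p ≡ anyFin q
anyFin-cong {zero} _ = refl
anyFin-cong {suc m} p≗q = cong₂ _∨_ (p≗q zero) (anyFin-cong (p≗q ∘ suc))

true≢false : ¬ true ≡ false
true≢false ()

∧-true⁻ : ∀ {a b} → a ∧ b ≡ true → a ≡ true × b ≡ true
∧-true⁻ {true} {true} refl = refl , refl

not-true⁻ : ∀ {a} → not a ≡ true → a ≡ false
not-true⁻ {false} refl = refl

<ᵇ-true⁻ : ∀ {m n} → (m <ᵇ n) ≡ true → m < n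
<ᵇ-true⁻ {m} {n} m<ᵇn = <ᵇ⇒< m n (Equivalence.from T-≡ m<ᵇn)

<ᵇ-true⁺ : ∀ {m n} → m < n → (m <ᵇ n) ≡ true
<ᵇ-true⁺ m<n = Equivalence.to T-≡ (<⇒<ᵇ m<n)

<ᵇ-irrefl : ∀ m → (m <ᵇ m) ≡ false
<ᵇ-irrefl zero = refl
<ᵇ-irrefl (suc m) = <ᵇ-irrefl m

≤ᵇ-true⁻ : ∀ {m n} → (m ≤ᵇ n) ≡ true → m ≤ n
≤ᵇ-true⁻ {m} {n} m≤ᵇn = ≤ᵇ⇒≤ m n (Equivalence.from T-≡ m≤ᵇn)

≤ᵇ-true⁺ : ∀ {m n} → m ≤ n → (m ≤ᵇ n) ≡ true
≤ᵇ-true⁺ m≤n = Equivalence.to T-≡ (≤⇒≤ᵇ m≤n)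

∈-tabulate⁻ : ∀ {m} {f : Fin m → Bool} {x} → x ∈ tabulate f → f x ≡ true
∈-tabulate⁻ {f = f} {x} x∈ = trans (sym (lookup∘tabulate f x)) ([]=⇒lookup x∈)

count≡∣tabulate∣ : ∀ {m} (f : Fin m → Bool) → count f ≡ ∣ tabulate f ∣
count≡∣tabulate∣ f = trans (count-cong (λ i → sym (lookup∘tabulate f i))) (count-lookup (tabulate f))

module HoleWords (N s : ℕ) where

  data Letter : Set where
    value : Fin N → Letter
    hole  : Fin s → Letter

  values : List Letter → Subset N
  values [] = ⊥
  values (value y ∷ w) = ⁅ y ⁆ ∪ values w
  values (hole _ ∷ w) = values w

  data HoleWord : ℕ → ℕ → List Letter → Set where
    []     : HoleWord 0 0 []
    hole∷  : ∀ {h j w} d → HoleWord h j w → HoleWord (suc h) j (hole d ∷ w)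
    value∷ : ∀ {h j w} y → y ∉ values w → HoleWord h j w → HoleWord h (suc j) (value y ∷ w)

  withHole : List (List Letter) → List (List Letter)
  withHole = concatMap λ w → map (λ d → hole d ∷ w) (allFin s)

  withFreshValue : List (List Letter) → List (List Letter)
  withFreshValue = concatMap λ w → map (λ y → value y ∷ w) (members (∁ (values w)))

  holeWords : ℕ → ℕ → List (List Letter)
  holeWords zero    zero    = [ [] ]
  holeWords zero    (suc j) = withFreshValue (holeWords zero j)
  holeWords (suc h) zero    = withHole (holeWords h zero)
  holeWords (suc h) (suc j) = withHole (holeWords h (suc j)) ++ withFreshValue (holeWords (suc h) j)

  ∈-withHole : ∀ {w ws} d → w ∈ₗ ws → (hole d ∷ w) ∈ₗ withHole ws
  ∈-withHole d w∈ws = ∈-concatMap⁺ _ (Any.map (λ { refl → ∈-map⁺ _ (∈-allFin d) }) w∈ws)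

  ∈-withFreshValue : ∀ {w ws} y → y ∉ values w → w ∈ₗ ws → (value y ∷ w) ∈ₗ withFreshValue ws
  ∈-withFreshValue y y∉ w∈ws =
    ∈-concatMap⁺ _ (Any.map (λ { refl → ∈-map⁺ _ (∈⇒∈members (x∉p⇒x∈∁p y∉)) }) w∈ws)

  ∈-holeWords : ∀ {h j w} → HoleWord h j w → w ∈ₗ holeWords h j
  ∈-holeWords [] = here refl
  ∈-holeWords (hole∷ {j = zero} d w) = ∈-withHole d (∈-holeWords w)
  ∈-holeWords (hole∷ {j = suc j} d w) = ∈-++⁺ˡ (∈-withHole d (∈-holeWords w))
  ∈-holeWords (value∷ {h = zero} y y∉ w) = ∈-withFreshValue y y∉ (∈-holeWords w)
  ∈-holeWords (value∷ {h = suc h} y y∉ w) = ∈-++⁺ʳ _ (∈-withFreshValue y y∉ (∈-holeWords w))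

  AtLeastValues : ℕ → List Letter → Set
  AtLeastValues j w = j ≤ ∣ values w ∣

  withHole-atLeastValues : ∀ {j ws} → All (AtLeastValues j) ws → All (AtLeastValues j) (withHole ws)
  withHole-atLeastValues ws = concat⁺ (map⁺ (All.map (λ w → map⁺ (All.universal (λ _ → w) _)) ws))

  withFreshValue-atLeastValues : ∀ {j ws} → All (AtLeastValues j) ws →
                                 All (AtLeastValues (suc j)) (withFreshValue ws)
  withFreshValue-atLeastValues ws = concat⁺ (map⁺ (All.map (λ {w} j≤ → map⁺ (All.tabulate λ y∈ →
    ≤-trans (s≤s j≤) (∣p∣<∣⁅x⁆∪p∣ (values w) (x∈∁p⇒x∉p (∈members⇒∈ _ y∈))))) ws))

  holeWords-atLeastValues : ∀ h j → All (AtLeastValues j) (holeWords h j)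
  holeWords-atLeastValues zero    zero    = z≤n ∷ []
  holeWords-atLeastValues zero    (suc j) = withFreshValue-atLeastValues (holeWords-atLeastValues zero j)
  holeWords-atLeastValues (suc h) zero    = withHole-atLeastValues (holeWords-atLeastValues h zero)
  holeWords-atLeastValues (suc h) (suc j) =
    ++⁺ (withHole-atLeastValues (holeWords-atLeastValues h (suc j)))
        (withFreshValue-atLeastValues (holeWords-atLeastValues (suc h) j))

  length-withHole : ∀ ws → length (withHole ws) ≤ s * length ws
  length-withHole ws = length-concatMap-≤ {c = s} _
    (All.universal (λ w → ≤-reflexive (trans (length-map _ (allFin s)) (length-tabulate {n = s} _))) ws)

  length-withFreshValue : ∀ {j ws} → All (AtLeastValues j) ws →
                          length (withFreshValue ws) ≤ (N ∸ j) * length ws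
  length-withFreshValue {j} ws = length-concatMap-≤ _ (All.map (λ {w} j≤ → begin
      length (map (λ y → value y ∷ w) (members (∁ (values w))))
    ≡⟨ length-map _ (members (∁ (values w))) ⟩
      length (members (∁ (values w)))
    ≡⟨ trans (length-members (∁ (values w))) (∣∁p∣≡n∸∣p∣ (values w)) ⟩
      N ∸ ∣ values w ∣
    ≤⟨ ∸-monoʳ-≤ N j≤ ⟩
      N ∸ j
    ∎) ws)
    where open ≤-Reasoning

  withHole-bound : ∀ {ws} h j r {x} → length ws * (h ! * j ! * r !) ≤ x →
                   length (withHole ws) * (suc h ! * j ! * r !) ≤ suc h * (s * x)
  withHole-bound {ws} h j r {x} ws≤x = begin
      length (withHole ws) * (suc h ! * j ! * r !)
    ≤⟨ *-monoˡ-≤ _ (length-withHole ws) ⟩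
      s * length ws * (suc h * h ! * j ! * r !)
    ≡⟨ solve 6 (λ s l h a b c → s :* l :* ((con 1 :+ h) :* a :* b :* c)
                             := (con 1 :+ h) :* (s :* (l :* (a :* b :* c))))
               refl s (length ws) h (h !) (j !) (r !) ⟩
      suc h * (s * (length ws * (h ! * j ! * r !)))
    ≤⟨ *-monoʳ-≤ (suc h) (*-monoʳ-≤ s ws≤x) ⟩
      suc h * (s * x)
    ∎
    where open ≤-Reasoning

  withFreshValue-bound : ∀ {ws} h j r {x} → N ≡ suc j + r → All (AtLeastValues j) ws →
                         length ws * (h ! * j ! * suc r !) ≤ x →
                         length (withFreshValue ws) * (h ! * suc j ! * r !) ≤ suc j * x
  withFreshValue-bound {ws} h j r {x} refl atLeastValues ws≤x = begin
      length (withFreshValue ws) * (h ! * suc j ! * r !)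
    ≤⟨ *-monoˡ-≤ _ (length-withFreshValue atLeastValues) ⟩
      (suc j + r ∸ j) * length ws * (h ! * (suc j * j !) * r !)
    ≡⟨ cong (λ m → m * length ws * (h ! * (suc j * j !) * r !))
            (trans (cong (_∸ j) (sym (+-suc j r))) (m+n∸m≡n j (suc r))) ⟩
      suc r * length ws * (h ! * (suc j * j !) * r !)
    ≡⟨ solve 6 (λ r l a j b c → (con 1 :+ r) :* l :* (a :* ((con 1 :+ j) :* b) :* c)
                             := (con 1 :+ j) :* (l :* (a :* b :* ((con 1 :+ r) :* c))))
               refl r (length ws) (h !) j (j !) (r !) ⟩
      suc j * (length ws * (h ! * j ! * suc r !))
    ≤⟨ *-monoʳ-≤ (suc j) ws≤x ⟩
      suc j * x
    ∎
    where open ≤-Reasoning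

  length-holeWords-≤ : ∀ h j r → N ≡ j + r →
                       length (holeWords h j) * (h ! * j ! * r !) ≤ (h + j) ! * s ^ h * N !
  length-holeWords-≤ zero zero r refl =
    ≤-reflexive (solve 1 (λ x → con 1 :* (con 1 :* con 1 :* x) := con 1 :* con 1 :* x) refl (r !))
  length-holeWords-≤ zero (suc j) r N≡ = ≤-trans
    (withFreshValue-bound {holeWords 0 j} 0 j r N≡ (holeWords-atLeastValues 0 j)
      (length-holeWords-≤ 0 j (suc r) (trans N≡ (sym (+-suc j r)))))
    (≤-reflexive (solve 3 (λ j a b → (con 1 :+ j) :* (a :* con 1 :* b) := (con 1 :+ j) :* a :* con 1 :* b)
                          refl j (j !) (N !)))
  length-holeWords-≤ (suc h) zero r N≡ = begin
      length (holeWords (suc h) 0) * (suc h ! * 1 * r !)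
    ≤⟨ withHole-bound {holeWords h 0} h 0 r (length-holeWords-≤ h 0 r N≡) ⟩
      suc h * (s * ((h + 0) ! * s ^ h * N !))
    ≡⟨ cong (λ m → suc h * (s * (m ! * s ^ h * N !))) (+-identityʳ h) ⟩
      suc h * (s * (h ! * s ^ h * N !))
    ≡⟨ solve 5 (λ h s a b c → (con 1 :+ h) :* (s :* (a :* b :* c)) := (con 1 :+ h) :* a :* (s :* b) :* c)
               refl h s (h !) (s ^ h) (N !) ⟩
      suc h ! * s ^ suc h * N !
    ≡⟨ cong (λ m → m ! * s ^ suc h * N !) (+-identityʳ (suc h)) ⟨
      (suc h + 0) ! * s ^ suc h * N !
    ∎
    where open ≤-Reasoning
  length-holeWords-≤ (suc h) (suc j) r N≡ = begin
      length (withHole a ++ withFreshValue b) * d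
    ≡⟨ cong (_* d) (length-++ (withHole a)) ⟩
      (length (withHole a) + length (withFreshValue b)) * d
    ≡⟨ *-distribʳ-+ d (length (withHole a)) _ ⟩
      length (withHole a) * d + length (withFreshValue b) * d
    ≤⟨ +-mono-≤ (withHole-bound {a} h (suc j) r (length-holeWords-≤ h (suc j) r N≡))
                (withFreshValue-bound {b} (suc h) j r N≡ (holeWords-atLeastValues (suc h) j)
                  (length-holeWords-≤ (suc h) j (suc r) (trans N≡ (sym (+-suc j r))))) ⟩
      suc h * (s * (x * s ^ h * N !)) + suc j * ((suc h + j) ! * s ^ suc h * N !)
    ≡⟨ cong (λ m → suc h * (s * (x * s ^ h * N !)) + suc j * (m ! * s ^ suc h * N !)) (+-suc h j) ⟨
      suc h * (s * (x * s ^ h * N !)) + suc j * (x * s ^ suc h * N !)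
    ≡⟨ solve 6 (λ h s j x p m → (con 1 :+ h) :* (s :* (x :* p :* m)) :+ (con 1 :+ j) :* (x :* (s :* p) :* m)
                             := (con 1 :+ (h :+ (con 1 :+ j))) :* x :* (s :* p) :* m)
               refl h s j x (s ^ h) (N !) ⟩
      (suc h + suc j) ! * s ^ suc h * N !
    ∎
    where
    open ≤-Reasoning
    a = holeWords h (suc j)
    b = holeWords (suc h) j
    d = suc h ! * suc j ! * r !
    x = (h + suc j) !

  isHole : Letter → Bool
  isHole (value _) = false
  isHole (hole _) = true

  ∈-values-tabulate⁻ : ∀ {m} (g : Fin m → Letter) {y} →
                       y ∈ values (List.tabulate g) → ∃[ i ] g i ≡ value y
  ∈-values-tabulate⁻ {zero} g y∈ = contradiction y∈ ∉⊥
  ∈-values-tabulate⁻ {suc m} g y∈ with g zero in g0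
  ... | hole _ = let i , gi = ∈-values-tabulate⁻ (g ∘ suc) y∈ in suc i , gi
  ... | value z with x∈p∪q⁻ ⁅ z ⁆ (values (List.tabulate (g ∘ suc))) y∈
  ...   | inj₁ y∈⁅z⁆ = zero , trans g0 (cong value (sym (x∈⁅y⁆⇒x≡y z y∈⁅z⁆)))
  ...   | inj₂ y∈rest = let i , gi = ∈-values-tabulate⁻ (g ∘ suc) y∈rest in suc i , gi

  tabulate-holeWord : ∀ {m} (g : Fin m → Letter) → (∀ {i j y} → g i ≡ value y → g j ≡ value y → i ≡ j) →
                      HoleWord (count (isHole ∘ g)) (count (not ∘ isHole ∘ g)) (List.tabulate g)
  tabulate-holeWord {zero} g _ = []
  tabulate-holeWord {suc m} g values-distinct with g zero in g0
  ... | hole d = hole∷ d (tabulate-holeWord (g ∘ suc) tail-values-distinct)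
    where
    tail-values-distinct : ∀ {i j y} → g (suc i) ≡ value y → g (suc j) ≡ value y → i ≡ j
    tail-values-distinct gi gj = Finₚ.suc-injective (values-distinct gi gj)
  ... | value y = value∷ y y∉rest (tabulate-holeWord (g ∘ suc) tail-values-distinct)
    where
    tail-values-distinct : ∀ {i j y} → g (suc i) ≡ value y → g (suc j) ≡ value y → i ≡ j
    tail-values-distinct gi gj = Finₚ.suc-injective (values-distinct gi gj)
    y∉rest : y ∉ values (List.tabulate (g ∘ suc))
    y∉rest y∈ with ∈-values-tabulate⁻ (g ∘ suc) y∈
    ... | i , gi with values-distinct gi g0
    ... | ()

position-agree-at : ∀ {n} {ρ τ : Permutation′ n} w →
                    ρ ⟨$⟩ˡ (ρ ⟨$⟩ʳ w) ≡ τ ⟨$⟩ˡ (ρ ⟨$⟩ʳ w) → ρ ⟨$⟩ʳ w ≡ τ ⟨$⟩ʳ w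
position-agree-at {ρ = ρ} {τ} w agree =
  trans (sym (inverseʳ τ)) (cong (τ ⟨$⟩ʳ_) (trans (sym agree) (inverseˡ ρ)))

module SinkRanks {n} (G : Digraph n) where

  sink : (Fin n → Bool) → Fin n → Bool
  sink T v = T v ∧ not (anyFin λ w → T w ∧ G v w)

  rank : (Fin n → Bool) → Fin n → ℕ
  rank T v = count λ w → sink T w ∧ (toℕ w <ᵇ toℕ v)

  sink-cong : ∀ {T T'} → (∀ v → T v ≡ T' v) → ∀ v → sink T v ≡ sink T' v
  sink-cong T≗T' v = cong₂ _∧_ (T≗T' v) (cong not (anyFin-cong λ w → cong (_∧ G v w) (T≗T' w)))

  rank-cong : ∀ {T T'} → (∀ v → T v ≡ T' v) → ∀ v → rank T v ≡ rank T' v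
  rank-cong T≗T' v = count-cong λ w → cong (_∧ (toℕ w <ᵇ toℕ v)) (sink-cong T≗T' w)

  sinks-independent : ∀ T → Independent (Arc G) (tabulate (sink T))
  sinks-independent T u v u∈ v∈ Guv = true≢false (trans (sym (cong₂ _∧_ Tv Guv)) no-arc)
    where
    Tv : T v ≡ true
    Tv = proj₁ (∧-true⁻ (∈-tabulate⁻ v∈))
    no-arc : T v ∧ G u v ≡ false
    no-arc = anyFin-false⁻ _ (not-true⁻ (proj₂ (∧-true⁻ (∈-tabulate⁻ {f = sink T} u∈)))) v

  not-before-itself : ∀ b (v : Fin n) → b ∧ (toℕ v <ᵇ toℕ v) ≡ false
  not-before-itself b v = trans (cong (b ∧_) (<ᵇ-irrefl (toℕ v))) (∧-zeroʳ b)

  rank-mono-< : ∀ T {v w} → sink T v ≡ true → toℕ v < toℕ w → rank T v < rank T w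
  rank-mono-< T {v} {w} sv v<w = count-mono-<
    (λ u u∈ → let su , u<v = ∧-true⁻ u∈ in cong₂ _∧_ su (<ᵇ-true⁺ (<-trans (<ᵇ-true⁻ u<v) v<w)))
    v (not-before-itself (sink T v) v) (cong₂ _∧_ sv (<ᵇ-true⁺ v<w))

  rank-injective : ∀ T {v w} → sink T v ≡ true → sink T w ≡ true → rank T v ≡ rank T w → v ≡ w
  rank-injective T {v} {w} sv sw rv≡rw with Finₚ.<-cmp v w
  ... | tri< v<w _ _ = contradiction rv≡rw (<⇒≢ (rank-mono-< T sv v<w))
  ... | tri≈ _ v≡w _ = v≡w
  ... | tri> _ _ w<v = contradiction (sym rv≡rw) (<⇒≢ (rank-mono-< T sw w<v))

  rank<#sinks : ∀ T {v} → sink T v ≡ true → rank T v < count (sink T)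
  rank<#sinks T {v} sv = count-mono-< (λ u u∈ → proj₁ (∧-true⁻ u∈)) v (not-before-itself (sink T v) v) sv

IndependentOfSize : ∀ {n} → Digraph n → ℕ → Permutation′ n → Set
IndependentOfSize {n} G k π = Σ[ S ∈ Subset n ] Independent (ArcPerm G π) S × ∣ S ∣ ≡ k

module Encoding {n} (s : ℕ) .{{_ : NonZero s}} (G : Digraph n) (loopless : ∀ v → G v v ≡ false)
                (α≤s : αAtMost (Arc G) s) where

  open SinkRanks G
  open HoleWords n s

  rank<s : ∀ T {v} → sink T v ≡ true → rank T v < s
  rank<s T sv = <-≤-trans (rank<#sinks T sv)
    (subst (_≤ s) (sym (count≡∣tabulate∣ (sink T))) (α≤s _ (sinks-independent T)))

  remaining : Permutation′ n → Subset n → Fin n → Fin n → Bool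
  remaining π S i w = lookup S w ∧ (toℕ i ≤ᵇ toℕ (π ⟨$⟩ʳ w))

  -- Ranks r ≥ s do not occur in codes (rank<s); label sends them to 0.
  label : ℕ → Fin s
  label r with r <? s
  ... | yes r<s = fromℕ< r<s
  ... | no _ = fromℕ< (>-nonZero⁻¹ s)

  toℕ-label : ∀ {r} → r < s → toℕ (label r) ≡ r
  toℕ-label {r} r<s with r <? s
  ... | yes r<s′ = Finₚ.toℕ-fromℕ< r<s′
  ... | no r≮s = contradiction r<s r≮s

  letter : Permutation′ n → Subset n → Fin n → Letter
  letter π S i = if lookup S v then hole (label (rank (remaining π S i) v)) else value v
    where v = π ⟨$⟩ˡ i

  code : Permutation′ n → Subset n → List Letter
  code π S = List.tabulate (letter π S)

  placed-sink : ∀ π S i → Independent (ArcPerm G π) S → lookup S (π ⟨$⟩ˡ i) ≡ true →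
                sink (remaining π S i) (π ⟨$⟩ˡ i) ≡ true
  placed-sink π S i indep Sv =
    cong₂ _∧_ (cong₂ _∧_ Sv (≤ᵇ-true⁺ (≤-reflexive (cong toℕ (sym pos-v)))))
              (cong not (anyFin-false⁺ _ no-later-arc))
    where
    v = π ⟨$⟩ˡ i
    pos-v : π ⟨$⟩ʳ v ≡ i
    pos-v = inverseʳ π
    no-later-arc : ∀ w → ¬ (remaining π S i w ∧ G v w ≡ true)
    no-later-arc w rw∧Gvw with ∧-true⁻ rw∧Gvw
    ... | rw , Gvw with ∧-true⁻ rw
    ... | Sw , i≤pos-w with m≤n⇒m<n∨m≡n (≤ᵇ-true⁻ i≤pos-w)
    ... | inj₁ i<pos-w = indep v w (lookup⇒[]= v S Sv) (lookup⇒[]= w S Sw)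
                           (Gvw , subst (λ j → toℕ j < toℕ (π ⟨$⟩ʳ w)) (sym pos-v) i<pos-w)
    ... | inj₂ i≡pos-w = true≢false (trans (sym Gvw) (trans (cong (G v) w≡v) (loopless v)))
      where
      w≡v : w ≡ v
      w≡v = trans (sym (inverseˡ π)) (cong (π ⟨$⟩ˡ_) (Finₚ.toℕ-injective (sym i≡pos-w)))

  letter-outside : ∀ π S i → lookup S (π ⟨$⟩ˡ i) ≡ false → letter π S i ≡ value (π ⟨$⟩ˡ i)
  letter-outside π S i Sv rewrite Sv = refl

  letter-inside : ∀ π S i → lookup S (π ⟨$⟩ˡ i) ≡ true →
                  letter π S i ≡ hole (label (rank (remaining π S i) (π ⟨$⟩ˡ i)))
  letter-inside π S i Sv rewrite Sv = refl

  letter-value⁻ : ∀ π S i {y} → letter π S i ≡ value y →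
                  lookup S (π ⟨$⟩ˡ i) ≡ false × π ⟨$⟩ˡ i ≡ y
  letter-value⁻ π S i eq with lookup S (π ⟨$⟩ˡ i)
  letter-value⁻ π S i refl | false = refl , refl

  letter-hole⁻ : ∀ π S i {d} → letter π S i ≡ hole d →
                 lookup S (π ⟨$⟩ˡ i) ≡ true × label (rank (remaining π S i) (π ⟨$⟩ˡ i)) ≡ d
  letter-hole⁻ π S i eq with lookup S (π ⟨$⟩ˡ i)
  letter-hole⁻ π S i refl | true = refl , refl

  outside-agree : ∀ {π σ S S′} → (∀ i → letter π S i ≡ letter σ S′ i) →
                  ∀ v → lookup S v ≡ false → lookup S′ v ≡ false
  outside-agree {π} {σ} {S} {S′} same v Sv = subst (λ u → lookup S′ u ≡ false) σ-i≡v S′σ-i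
    where
    i = π ⟨$⟩ʳ v
    Sπ-i : lookup S (π ⟨$⟩ˡ i) ≡ false
    Sπ-i = trans (cong (lookup S) (inverseˡ π)) Sv
    σ-letter = letter-value⁻ σ S′ i (trans (sym (same i)) (letter-outside π S i Sπ-i))
    S′σ-i = proj₁ σ-letter
    σ-i≡v : σ ⟨$⟩ˡ i ≡ v
    σ-i≡v = trans (proj₂ σ-letter) (inverseˡ π)

  module Decoding {π σ : Permutation′ n} {S S′ : Subset n}
                  (indep-π : Independent (ArcPerm G π) S) (indep-σ : Independent (ArcPerm G σ) S′)
                  (same : ∀ i → letter π S i ≡ letter σ S′ i) where

    same-subset : ∀ v → lookup S v ≡ lookup S′ v
    same-subset v with lookup S v in Sv | lookup S′ v in S′v
    ... | true  | true  = refl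
    ... | false | false = refl
    ... | true  | false =
      contradiction (trans (sym Sv) (outside-agree {σ} {π} {S′} {S} (sym ∘ same) v S′v)) true≢false
    ... | false | true  =
      contradiction (trans (sym S′v) (outside-agree {π} {σ} {S} {S′} same v Sv)) true≢false

    module _ (i : Fin n) (agree-below : ∀ {j} → j Fin.< i → π ⟨$⟩ˡ j ≡ σ ⟨$⟩ˡ j) where

      placed-from-i-agree : ∀ w → (toℕ i ≤ᵇ toℕ (π ⟨$⟩ʳ w)) ≡ (toℕ i ≤ᵇ toℕ (σ ⟨$⟩ʳ w))
      placed-from-i-agree w with π ⟨$⟩ʳ w Finₚ.<? i | σ ⟨$⟩ʳ w Finₚ.<? i
      ... | yes πw<i | _ =
        cong (λ j → toℕ i ≤ᵇ toℕ j) (position-agree-at {ρ = π} {σ} w (agree-below πw<i))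
      ... | no _ | yes σw<i =
        cong (λ j → toℕ i ≤ᵇ toℕ j) (sym (position-agree-at {ρ = σ} {π} w (sym (agree-below σw<i))))
      ... | no πw≮i | no σw≮i = trans (≤ᵇ-true⁺ (≮⇒≥ πw≮i)) (sym (≤ᵇ-true⁺ (≮⇒≥ σw≮i)))

      remaining-agree : ∀ w → remaining π S i w ≡ remaining σ S′ i w
      remaining-agree w = cong₂ _∧_ (same-subset w) (placed-from-i-agree w)

      vertex-agree-at : π ⟨$⟩ˡ i ≡ σ ⟨$⟩ˡ i
      vertex-agree-at with lookup S (π ⟨$⟩ˡ i) in Sv
      ... | false = sym (proj₂ (letter-value⁻ σ S′ i (trans (sym (same i)) (letter-outside π S i Sv))))
      ... | true = rank-injective Tπ sink-v sink-v′ (begin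
            rank Tπ v                ≡⟨ toℕ-label (rank<s Tπ sink-v) ⟨
            toℕ (label (rank Tπ v))  ≡⟨ cong toℕ (proj₂ σ-letter) ⟨
            toℕ (label (rank Tσ v′)) ≡⟨ toℕ-label (rank<s Tσ sinkσ-v′) ⟩
            rank Tσ v′               ≡⟨ rank-cong remaining-agree v′ ⟨
            rank Tπ v′               ∎)
        where
        open ≡-Reasoning
        v = π ⟨$⟩ˡ i
        v′ = σ ⟨$⟩ˡ i
        Tπ = remaining π S i
        Tσ = remaining σ S′ i
        σ-letter = letter-hole⁻ σ S′ i (trans (sym (same i)) (letter-inside π S i Sv))
        sink-v : sink Tπ v ≡ true
        sink-v = placed-sink π S i indep-π Sv
        sinkσ-v′ : sink Tσ v′ ≡ true
        sinkσ-v′ = placed-sink σ S′ i indep-σ (proj₁ σ-letter)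
        sink-v′ : sink Tπ v′ ≡ true
        sink-v′ = trans (sink-cong remaining-agree v′) sinkσ-v′

    vertex-agree : ∀ i → π ⟨$⟩ˡ i ≡ σ ⟨$⟩ˡ i
    vertex-agree = WF.All.wfRec <-wellFounded 0ℓ (λ i → π ⟨$⟩ˡ i ≡ σ ⟨$⟩ˡ i) vertex-agree-at

    position-agree : ∀ u → π ⟨$⟩ʳ u ≡ σ ⟨$⟩ʳ u
    position-agree u = position-agree-at {ρ = π} {σ} u (vertex-agree (π ⟨$⟩ʳ u))

  code-injective : ∀ {π σ S S′} → Independent (ArcPerm G π) S → Independent (ArcPerm G σ) S′ →
                   code π S ≡ code σ S′ → ∀ u → π ⟨$⟩ʳ u ≡ σ ⟨$⟩ʳ u
  code-injective {π} {σ} {S} {S′} indep-π indep-σ same =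
    Decoding.position-agree {π} {σ} {S} {S′} indep-π indep-σ
      (tabulate-injective (letter π S) (letter σ S′) same)

  code-holeWord : ∀ π S → HoleWord ∣ S ∣ (n ∸ ∣ S ∣) (code π S)
  code-holeWord π S = subst₂ (λ h j → HoleWord h j (code π S)) #holes #values
    (tabulate-holeWord (letter π S) values-distinct)
    where
    isHole-letter : ∀ i → isHole (letter π S i) ≡ lookup S (π ⟨$⟩ˡ i)
    isHole-letter i with lookup S (π ⟨$⟩ˡ i)
    ... | true = refl
    ... | false = refl
    #holes : count (isHole ∘ letter π S) ≡ ∣ S ∣
    #holes = trans (count-cong isHole-letter) (trans (count-permute (lookup S) π) (count-lookup S))
    #values : count (not ∘ isHole ∘ letter π S) ≡ n ∸ ∣ S ∣
    #values = trans (sym (m+n∸m≡n (count (isHole ∘ letter π S)) _))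
                    (cong₂ _∸_ (count+count-not (isHole ∘ letter π S)) #holes)
    values-distinct : ∀ {i j y} → letter π S i ≡ value y → letter π S j ≡ value y → i ≡ j
    values-distinct {i} {j} li lj = begin
      i                  ≡⟨ inverseʳ π ⟨
      π ⟨$⟩ʳ (π ⟨$⟩ˡ i)  ≡⟨ cong (π ⟨$⟩ʳ_) same-vertex ⟩
      π ⟨$⟩ʳ (π ⟨$⟩ˡ j)  ≡⟨ inverseʳ π ⟩
      j                  ∎
      where
      open ≡-Reasoning
      same-vertex : π ⟨$⟩ˡ i ≡ π ⟨$⟩ˡ j
      same-vertex = trans (proj₂ (letter-value⁻ π S i li)) (sym (proj₂ (letter-value⁻ π S j lj)))

  bad⇒independentOfSize : ∀ {k π} → (∀ {x} → 16 * n * s < x * x → k ≤ x) →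
                          Bad s G π → IndependentOfSize G k π
  bad⇒independentOfSize k-least (S , indep , 16ns<∣S∣²) with subset-of-size S (k-least 16ns<∣S∣²)
  ... | S′ , S′⊆S , ∣S′∣≡k = S′ , Independent-⊆ S′⊆S indep , ∣S′∣≡k

  code∈holeWords : ∀ {k} π S → ∣ S ∣ ≡ k → code π S ∈ₗ holeWords k (n ∸ k)
  code∈holeWords π S refl = ∈-holeWords (code-holeWord π S)

  length≤#holeWords : ∀ {k} {L : List (Permutation′ n)} → AllPairs Distinct L → All (IndependentOfSize G k) L →
                      length L ≤ length (holeWords k (n ∸ k))
  length≤#holeWords {k} {L} distinct indeps = length≤-by-separating-code distinct (Any.index ∘ code∈) separates
    where
    π : Fin (length L) → Permutation′ n
    π = List.lookup L
    witness : ∀ i → IndependentOfSize G k (π i)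
    witness i = All.lookup indeps (∈-lookup i)
    S : Fin (length L) → Subset n
    S i = proj₁ (witness i)
    code∈ : ∀ i → code (π i) (S i) ∈ₗ holeWords k (n ∸ k)
    code∈ i = code∈holeWords (π i) (S i) (proj₂ (proj₂ (witness i)))
    separates : ∀ i j → Any.index (code∈ i) ≡ Any.index (code∈ j) → ¬ Distinct (π i) (π j)
    separates i j same-index distinct =
      distinct (code-injective {π i} {π j} (proj₁ (proj₂ (witness i))) (proj₁ (proj₂ (witness j))) (begin
        code (π i) (S i)                       ≡⟨ lookup-index (code∈ i) ⟩
        List.lookup ws (Any.index (code∈ i))  ≡⟨ cong (List.lookup ws) same-index ⟩
        List.lookup ws (Any.index (code∈ j))  ≡⟨ lookup-index (code∈ j) ⟨
        code (π j) (S j)                       ∎))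
      where
      open ≡-Reasoning
      ws = holeWords k (n ∸ k)

  #permutations*2^[k/3]≤n! : ∀ {k} {L : List (Permutation′ n)} → AllPairs Distinct L →
                             All (IndependentOfSize G k) L → k ≤ n → 16 * n * s < k * k →
                             length L * 2 ^ (k / 3) ≤ n !
  #permutations*2^[k/3]≤n! {k} {L} distinct indeps k≤n 16ns<k² =
    *-cancelʳ-≤ (length L * 2 ^ (k / 3)) (n !) d (begin
      length L * 2 ^ (k / 3) * d
    ≤⟨ *-monoˡ-≤ d (*-monoˡ-≤ (2 ^ (k / 3)) (length≤#holeWords distinct indeps)) ⟩
      ℓ * 2 ^ (k / 3) * d
    ≡⟨ solve 3 (λ l t d → l :* t :* d := t :* (l :* d)) refl ℓ (2 ^ (k / 3)) d ⟩
      2 ^ (k / 3) * (ℓ * d)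
    ≤⟨ *-monoʳ-≤ (2 ^ (k / 3)) (length-holeWords-≤ k j k n≡j+k) ⟩
      2 ^ (k / 3) * ((k + j) ! * s ^ k * n !)
    ≡⟨ solve 4 (λ t f p m → t :* (f :* p :* m) := m :* (f :* p :* t))
               refl (2 ^ (k / 3)) ((k + j) !) (s ^ k) (n !) ⟩
      n ! * ((k + j) ! * s ^ k * 2 ^ (k / 3))
    ≤⟨ *-monoʳ-≤ (n !) ([k+j]!*s^k*2^[k/3]≤k!*j!*k! k j s (subst (λ m → 16 * m * s < k * k) n≡k+j 16ns<k²)) ⟩
      n ! * d
    ∎)
    where
    open ≤-Reasoning
    j = n ∸ k
    ℓ = length (holeWords k j)
    d = k ! * j ! * k !
    instance
      d≢0 : NonZero d
      d≢0 = m*n≢0 (k ! * j !) (k !) {{m*n≢0 (k !) (j !) {{k !≢0}} {{j !≢0}}}} {{k !≢0}}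
    n≡k+j : n ≡ k + j
    n≡k+j = sym (m+[n∸m]≡n k≤n)
    n≡j+k : n ≡ j + k
    n≡j+k = trans n≡k+j (+-comm k j)

  #bad*2^[k/3]≤n! : ∀ {k} → 16 * n * s < k * k → (∀ {x} → 16 * n * s < x * x → k ≤ x) →
                    ∀ {L} → AllPairs Distinct L → All (Bad s G) L → length L * 2 ^ (k / 3) ≤ n !
  #bad*2^[k/3]≤n! 16ns<k² k-least {[]} _ _ = z≤n
  #bad*2^[k/3]≤n! 16ns<k² k-least {_ ∷ _} distinct bads@((S , _ , 16ns<∣S∣²) ∷ _) =
    #permutations*2^[k/3]≤n! distinct (All.map (λ {π} → bad⇒independentOfSize {π = π} k-least) bads)
      (≤-trans (k-least 16ns<∣S∣²) (∣p∣≤n S)) 16ns<k²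

lemma3p3 : (n s : ℕ) → 1 ≤ s → (G : Digraph n) → IsOrientation G →
    αAtMost (Arc G) s →
    (L : List (Permutation′ n)) → AllPairs Distinct L → All (Bad s G) L →
    (a b : ℕ) → 1 ≤ b → a * a ≤ n * (b * b) →
    length L ^ b * 2 ^ a ≤ (n !) ^ b
lemma3p3 n s 1≤s G (loopless , _) α≤s L distinct bad a b _ a²≤nb² = begin
    length L ^ b * 2 ^ a
  ≤⟨ *-monoʳ-≤ (length L ^ b) (^-monoʳ-≤ 2 (a≤[k/3]*b n k a b 16n<k² a²≤nb²)) ⟩
    length L ^ b * 2 ^ (k / 3 * b)
  ≡⟨ cong (length L ^ b *_) (^-*-assoc 2 (k / 3) b) ⟨
    length L ^ b * (2 ^ (k / 3)) ^ b
  ≡⟨ ^-distribʳ-* (length L) (2 ^ (k / 3)) b ⟨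
    (length L * 2 ^ (k / 3)) ^ b
  ≤⟨ ^-monoˡ-≤ b (Encoding.#bad*2^[k/3]≤n! s G loopless α≤s 16ns<k² k-least distinct bad) ⟩
    (n !) ^ b
  ∎
  where
  open ≤-Reasoning
  instance
    s≢0 : NonZero s
    s≢0 = >-nonZero 1≤s
  least : Σ[ k ∈ ℕ ] 16 * n * s < k * k × (∀ {x} → 16 * n * s < x * x → k ≤ x)
  least = least-witness (λ k → 16 * n * s <? k * k) (suc (16 * n * s))
                        (m≤m*n (suc (16 * n * s)) (suc (16 * n * s)))
  k : ℕ
  k = proj₁ least
  16ns<k² : 16 * n * s < k * k
  16ns<k² = proj₁ (proj₂ least)
  k-least : ∀ {x} → 16 * n * s < x * x → k ≤ x
  k-least = proj₂ (proj₂ least)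
  16n<k² : 16 * n < k * k
  16n<k² = ≤-<-trans (m≤m*n (16 * n) s) 16ns<k²
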